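{- Let $k\ge 2$ be an integer. Every directed graph $D$ on $n$ vertices with minimum out-degree at least $\frac{n\log(2k)}{k-1}$ contains at least $\frac{n^\ell}{2k^{\ell+1}}$ directed cycles of length $\ell$, for some integer $\ell$ with $2\le \ell\le k$.
   Context: Directed graphs are simple: no loops and at most one edge from any vertex to any other vertex, but edges in both directions between two vertices are allowed (so directed cycles of length $2$ are possible). $\log$ denotes the natural logarithm. -}

module Defs where

open import Data.Bool using (Bool; true; false; _∧_; not)
open import Data.Nat using (ℕ; zero; suc; _+_; _*_; _∸_; _^_; _<_; _≤_; _/_; _!)
open import Data.Fin using (Fin)
open import Data.Fin.Properties using (_≟_)
open import Data.List using (List; []; _∷_; [_]; _++_; length; map; concatMap; allFin; filterᵇ)
open import Data.Product using (∃)
open import Data.Bool.ListAction using (any)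
open import Relation.Nullary.Decidable using (⌊_⌋)
open import Relation.Binary.PropositionalEquality using (_≡_)

-- Simple directed graphs on the vertex set Fin n:
-- no loops, at most one edge u → v for each ordered pair (u , v);
-- edges in both directions between two vertices are allowed.

record Digraph (n : ℕ) : Set where
  field
    adj      : Fin n → Fin n → Bool
    loopless : ∀ v → adj v v ≡ false
open Digraph public

outdeg : ∀ {n} → Digraph n → Fin n → ℕ
outdeg {n} D v = length (filterᵇ (adj D v) (allFin n))

-- A directed cycle of length ℓ ≥ 2 is determined by a sequence
-- (v₀ , … , v_{ℓ-1}) of distinct vertices with edges v_i → v_{i+1}
-- and v_{ℓ-1} → v₀, up to the ℓ cyclic rotations.  We count such
-- sequences and divide by ℓ.

allLists : (n ℓ : ℕ) → List (List (Fin n))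
allLists n zero    = [] ∷ []
allLists n (suc ℓ) = concatMap (λ x → map (x ∷_) (allLists n ℓ)) (allFin n)

distinctᵇ : ∀ {n} → List (Fin n) → Bool
distinctᵇ []       = true
distinctᵇ (x ∷ xs) = not (any (λ y → ⌊ x ≟ y ⌋) xs) ∧ distinctᵇ xs

pathᵇ : ∀ {n} → Digraph n → List (Fin n) → Bool
pathᵇ D (x ∷ y ∷ xs) = adj D x y ∧ pathᵇ D (y ∷ xs)
pathᵇ D _            = true

closedᵇ : ∀ {n} → Digraph n → List (Fin n) → Bool
closedᵇ D []       = true
closedᵇ D (x ∷ xs) = pathᵇ D (x ∷ xs ++ [ x ])

cycleSeqCount : ∀ {n} → Digraph n → ℕ → ℕ
cycleSeqCount {n} D ℓ =
  length (filterᵇ (λ xs → distinctᵇ xs ∧ closedᵇ D xs) (allLists n ℓ))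

numCycles : ∀ {n} → Digraph n → ℕ → ℕ
numCycles D zero    = 0
numCycles D (suc m) = cycleSeqCount D (suc m) / suc m

-- Real-number comparison involving the natural logarithm, encoded
-- with naturals only.
--
-- expScaled m N = N! · Σ_{i=0}^{N} m^i / i!   (N! times the N-th partial
-- sum of the exponential series at m), via
-- (N+1)! S_{N+1} = (N+1)·N! S_N + m^{N+1}.

expScaled : ℕ → ℕ → ℕ
expScaled m zero    = 1
expScaled m (suc N) = suc N * expScaled m N + m ^ suc N

-- ExpAtLeast m C  means  e^m ≥ C  (as real numbers), i.e.
-- for every ε = 1/q > 0 some partial sum S_N of the exponential series
-- exceeds C − 1/q:   q·C·N! < q·(N!·S_N) + N!.
ExpAtLeast : ℕ → ℕ → Set
ExpAtLeast m C = ∀ q → 1 ≤ q → ∃ λ N → q * C * (N !) < q * expScaled m N + N !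

-- OutDegBound n k d  means  d ≥ n·log(2k)/(k−1)  (for k ≥ 2),
-- i.e. (k−1)·d ≥ n·log(2k), i.e. e^{(k−1)d} ≥ (2k)^n.
OutDegBound : ℕ → ℕ → ℕ → Set
OutDegBound n k d = ExpAtLeast ((k ∸ 1) * d) ((2 * k) ^ n)

MinOutDegAtLeastLog : ∀ {n} → Digraph n → ℕ → Set
MinOutDegAtLeastLog {n} D k = ∀ v → OutDegBound n k (outdeg D v)

-- Count the n^k sequences s of k vertices, and call s good if every vertex of s has an
-- out-neighbour in s. A good s contains a directed cycle of some length 2 ≤ ℓ ≤ k, and a fixed
-- ℓ-cycle lies inside a random s with probability at most (k/n)^ℓ; so if every length ℓ had fewer
-- than n^ℓ/(2k^{ℓ+1}) cycles, s would be good with probability below (k-1)/(2k) < 1/2.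
-- On the other hand s is bad only if, for some v in s, s avoids the out-neighbourhood of v.
-- For fixed v this has probability at most (k/n)(1 - d⁺(v)/n)^{k-1} ≤ (k/n) e^{-(k-1)d⁺(v)/n},
-- which is at most 1/(2n) by the degree bound, so s is bad with probability at most 1/2.
-- The exponential enters only through its partial sums S_N, via S_N(mx) (1 - x)^m ≤ 1.

module Submission where

open import Defs
open import Data.Bool using (Bool; true; false; _∧_; _∨_; not)
open import Data.Bool.ListAction using (any; all)
open import Data.Bool.Properties
  using (∧-comm; ∧-assoc; ∧-zeroʳ; ∧-identityʳ; ∧-conicalˡ; ∧-conicalʳ;
         ∨-identityʳ; ∨-conicalˡ; ∨-conicalʳ)
open import Data.Fin using (Fin) renaming (zero to fzero; suc to fsuc; _≤_ to _≤ᶠ_)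
import Data.Fin.Properties as Fin
open import Data.List
  using (List; []; _∷_; [_]; _++_; length; map; concat; concatMap; filterᵇ; upTo; applyUpTo; allFin; tabulate)
open import Data.List.Properties using (++-assoc; ++-identityʳ; length-++; length-upTo; length-tabulate)
open import Data.List.Membership.Propositional using (_∈_)
open import Data.List.Membership.Propositional.Properties
  using (∈-++⁺ˡ; ∈-++⁺ʳ; ∈-++⁻; ∈-∃++; ∈-allFin; ∈-upTo⁺; ∈-upTo⁻)
import Data.List.Relation.Unary.All as All
open import Data.List.Relation.Unary.Any using (here; there)
open import Data.Nat using (ℕ; zero; suc; _+_; _*_; _^_; _≤_; _<_; _/_; _!; _≤?_; z≤n; s≤s; NonZero)
open import Data.Nat.DivMod using (m*n/n≡m; /-monoˡ-≤)
open import Data.Nat.Properties hiding (≤ᵇ⇒≤; ≤⇒≤ᵇ)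
open import Algebra.Properties.CommutativeSemigroup +-commutativeSemigroup using (interchange)
open import Algebra.Properties.CommutativeSemigroup *-commutativeSemigroup
  using (xy∙z≈y∙xz; x∙yz≈y∙xz; xy∙z≈x∙zy; x∙yz≈yx∙z)
open import Data.Nat.Tactic.RingSolver using (solve-∀)
open import Data.Product using (Σ; Σ-syntax; ∃-syntax; _×_; _,_)
open import Data.Sum using (inj₁; inj₂)
open import Function using (_∘_; id)
open import Relation.Binary.PropositionalEquality
  using (_≡_; refl; sym; trans; cong; cong₂; subst; subst₂; module ≡-Reasoning)
open import Relation.Nullary using (¬_; yes; no; contradiction)
open import Relation.Nullary.Decidable using (⌊_⌋)

-- Powers and truncated exponential series

^-distribʳ-* : ∀ m n o → (m * n) ^ o ≡ m ^ o * n ^ o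
^-distribʳ-* m n zero    = refl
^-distribʳ-* m n (suc o) rewrite ^-distribʳ-* m n o = lemma m n (m ^ o) (n ^ o)
  where
  lemma : ∀ m n x y → (m * n) * (x * y) ≡ (m * x) * (n * y)
  lemma = solve-∀

pow-mean-value : ∀ a b m → (a + b) ^ suc m ≤ b ^ suc m + suc m * a * (a + b) ^ m
pow-mean-value a b zero = ≤-reflexive (lemma a b)
  where
  lemma : ∀ a b → (a + b) * 1 ≡ b * 1 + 1 * a * 1
  lemma = solve-∀
pow-mean-value a b (suc m) = begin
    (a + b) * (a + b) ^ suc m
  ≤⟨ *-monoʳ-≤ (a + b) (pow-mean-value a b m) ⟩
    (a + b) * (b ^ suc m + suc m * a * (a + b) ^ m)
  ≡⟨ expand a b (b ^ suc m) (suc m) ((a + b) ^ m) ⟩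
    b * b ^ suc m + a * b ^ suc m + suc m * a * (a + b) ^ suc m
  ≤⟨ +-monoˡ-≤ _ (+-monoʳ-≤ (b * b ^ suc m) (*-monoʳ-≤ a (^-monoˡ-≤ (suc m) (m≤n+m b a)))) ⟩
    b * b ^ suc m + a * (a + b) ^ suc m + suc m * a * (a + b) ^ suc m
  ≡⟨ collect (b * b ^ suc m) a ((a + b) ^ suc m) (suc m) ⟩
    b ^ suc (suc m) + suc (suc m) * a * (a + b) ^ suc m ∎
  where
  open ≤-Reasoning
  expand : ∀ a b B M P → (a + b) * (B + M * a * P) ≡ b * B + a * B + M * a * ((a + b) * P)
  expand = solve-∀
  collect : ∀ bB a Q M → bB + a * Q + M * a * Q ≡ bB + (1 + M) * a * Q
  collect = solve-∀

[1+l]k^l+k^[1+l]≤[1+k]^[1+l] : ∀ k l → suc l * k ^ l + k * k ^ l ≤ suc k ^ suc l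
[1+l]k^l+k^[1+l]≤[1+k]^[1+l] k zero    = ≤-reflexive (lemma k)
  where
  lemma : ∀ k → 1 * 1 + k * 1 ≡ (1 + k) * 1
  lemma = solve-∀
[1+l]k^l+k^[1+l]≤[1+k]^[1+l] k (suc l) = begin
    suc (suc l) * (k * k ^ l) + k * (k * k ^ l)
  ≤⟨ m≤m+n _ (suc l * k ^ l) ⟩
    suc (suc l) * (k * k ^ l) + k * (k * k ^ l) + suc l * k ^ l
  ≡⟨ lemma (suc l) (k ^ l) k ⟨
    X + k * X
  ≤⟨ +-mono-≤ ([1+l]k^l+k^[1+l]≤[1+k]^[1+l] k l) (*-monoʳ-≤ k ([1+l]k^l+k^[1+l]≤[1+k]^[1+l] k l)) ⟩
    suc k ^ suc l + k * suc k ^ suc l ∎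
  where
  open ≤-Reasoning
  X = suc l * k ^ l + k * k ^ l
  lemma : ∀ l P k → (l * P + k * P) + k * (l * P + k * P) ≡ ((1 + l) * (k * P) + k * (k * P)) + l * P
  lemma = solve-∀

-- expTrunc u c N = N! · c^N · Σ_{i ≤ N} (u/c)^i / i!, the scaled N-th partial sum of e^{u/c}.
expTrunc : ℕ → ℕ → ℕ → ℕ
expTrunc u c zero    = 1
expTrunc u c (suc N) = suc N * c * expTrunc u c N + u ^ suc N

expTrunc-*ˡ : ∀ c u N → expTrunc (c * u) c N ≡ c ^ N * expScaled u N
expTrunc-*ˡ c u zero    = refl
expTrunc-*ˡ c u (suc N) = begin-equality
    suc N * c * expTrunc (c * u) c N + (c * u) ^ suc N
  ≡⟨ cong₂ (λ a b → suc N * c * a + b) (expTrunc-*ˡ c u N) (^-distribʳ-* c u (suc N)) ⟩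
    suc N * c * (c ^ N * expScaled u N) + c ^ suc N * u ^ suc N
  ≡⟨ lemma (suc N) c (c ^ N) (expScaled u N) (u ^ suc N) ⟩
    c ^ suc N * expScaled u (suc N) ∎
  where
  open ≤-Reasoning
  lemma : ∀ M c X E U → M * c * (X * E) + (c * X) * U ≡ (c * X) * (M * E + U)
  lemma = solve-∀

expTrunc-zero : ∀ c N → expTrunc 0 c N ≡ N ! * c ^ N
expTrunc-zero c zero    = refl
expTrunc-zero c (suc N) rewrite expTrunc-zero c N = lemma (suc N) c (N !) (c ^ N)
  where
  lemma : ∀ M c F X → M * c * (F * X) + 0 ≡ (M * F) * (c * X)
  lemma = solve-∀

-- The truncated form of  S(x + y) ≤ S(x) + y · S'(x + y)  for the partial sums S of exp.
expTrunc-suc-+-≤ : ∀ a b c N →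
  expTrunc (a + b) c (suc N) ≤ expTrunc b c (suc N) + suc N * a * expTrunc (a + b) c N
expTrunc-suc-+-≤ a b c zero = ≤-reflexive (lemma c a b)
  where
  lemma : ∀ c a b → 1 * c * 1 + (a + b) * 1 ≡ 1 * c * 1 + b * 1 + 1 * a * 1
  lemma = solve-∀
expTrunc-suc-+-≤ a b c (suc N) = begin
    suc (suc N) * c * expTrunc (a + b) c (suc N) + (a + b) ^ suc (suc N)
  ≤⟨ +-mono-≤ (*-monoʳ-≤ (suc (suc N) * c) (expTrunc-suc-+-≤ a b c N)) (pow-mean-value a b (suc N)) ⟩
    suc (suc N) * c * (expTrunc b c (suc N) + suc N * a * expTrunc (a + b) c N)
      + (b ^ suc (suc N) + suc (suc N) * a * (a + b) ^ suc N)
  ≡⟨ lemma (suc (suc N)) c (expTrunc b c (suc N)) (suc N) a (expTrunc (a + b) c N)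
           ((a + b) ^ suc N) (b ^ suc (suc N)) ⟩
    expTrunc b c (suc (suc N)) + suc (suc N) * a * expTrunc (a + b) c (suc N) ∎
  where
  open ≤-Reasoning
  lemma : ∀ M c X L a Y P B → M * c * (X + L * a * Y) + (B + M * a * P)
                              ≡ (M * c * X + B) + M * a * (L * c * Y + P)
  lemma = solve-∀

expTrunc-+-≤ : ∀ a b c N → c * expTrunc (a + b) c N ≤ c * expTrunc b c N + a * expTrunc (a + b) c N
expTrunc-+-≤ a b c zero    = m≤m+n (c * 1) (a * 1)
expTrunc-+-≤ a b c (suc N) = begin
    c * expTrunc (a + b) c (suc N)
  ≤⟨ *-monoʳ-≤ c (expTrunc-suc-+-≤ a b c N) ⟩
    c * (expTrunc b c (suc N) + suc N * a * expTrunc (a + b) c N)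
  ≡⟨ lemma c (expTrunc b c (suc N)) (suc N) a (expTrunc (a + b) c N) ⟩
    c * expTrunc b c (suc N) + a * (suc N * c * expTrunc (a + b) c N)
  ≤⟨ +-monoʳ-≤ (c * expTrunc b c (suc N)) (*-monoʳ-≤ a (m≤m+n _ _)) ⟩
    c * expTrunc b c (suc N) + a * expTrunc (a + b) c (suc N) ∎
  where
  open ≤-Reasoning
  lemma : ∀ c X M a Y → c * (X + M * a * Y) ≡ c * X + a * (M * c * Y)
  lemma = solve-∀

expTrunc-shift : ∀ {a d n} b N → a + d ≡ n → a * expTrunc (d + b) n N ≤ n * expTrunc b n N
expTrunc-shift {a} {d} {n} b N refl = +-cancelʳ-≤ (d * X) (a * X) (n * expTrunc b n N) (begin
    a * X + d * X          ≡⟨ *-distribʳ-+ X a d ⟨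
    n * X                  ≤⟨ expTrunc-+-≤ d b n N ⟩
    n * expTrunc b n N + d * X ∎)
  where
  open ≤-Reasoning
  X = expTrunc (d + b) n N

-- (1 - d/n)^i · S(i d / n) ≤ S(0) = 1, the truncated form of (1 - x)^i e^{i x} ≤ 1.
expTrunc-iterate : ∀ {a d n} N i → a + d ≡ n → a ^ i * expTrunc (i * d) n N ≤ n ^ i * expTrunc 0 n N
expTrunc-iterate N zero    a+d≡n = ≤-refl
expTrunc-iterate {a} {d} {n} N (suc i) a+d≡n = begin
    a * a ^ i * expTrunc (d + i * d) n N
  ≡⟨ xy∙z≈y∙xz a (a ^ i) _ ⟩
    a ^ i * (a * expTrunc (d + i * d) n N)
  ≤⟨ *-monoʳ-≤ (a ^ i) (expTrunc-shift {a} {d} {n} (i * d) N a+d≡n) ⟩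
    a ^ i * (n * expTrunc (i * d) n N)
  ≡⟨ x∙yz≈y∙xz (a ^ i) n _ ⟩
    n * (a ^ i * expTrunc (i * d) n N)
  ≤⟨ *-monoʳ-≤ n (expTrunc-iterate N i a+d≡n) ⟩
    n * (n ^ i * expTrunc 0 n N)
  ≡⟨ *-assoc n (n ^ i) _ ⟨
    n * n ^ i * expTrunc 0 n N ∎
  where open ≤-Reasoning

expScaled-bound : ∀ {a d n} .{{_ : NonZero n}} r N → a + d ≡ n →
  a ^ (r * n) * expScaled (r * d) N ≤ n ^ (r * n) * N !
expScaled-bound {a} {d} {n} r N a+d≡n = *-cancelʳ-≤ _ _ (n ^ N) {{m^n≢0 n N}} (begin
    a ^ (r * n) * expScaled (r * d) N * n ^ N
  ≡⟨ xy∙z≈x∙zy (a ^ (r * n)) _ _ ⟩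
    a ^ (r * n) * (n ^ N * expScaled (r * d) N)
  ≡⟨ cong (a ^ (r * n) *_) (expTrunc-*ˡ n (r * d) N) ⟨
    a ^ (r * n) * expTrunc (n * (r * d)) n N
  ≡⟨ cong (λ u → a ^ (r * n) * expTrunc u n N) (x∙yz≈yx∙z n r d) ⟩
    a ^ (r * n) * expTrunc (r * n * d) n N
  ≤⟨ expTrunc-iterate N (r * n) a+d≡n ⟩
    n ^ (r * n) * expTrunc 0 n N
  ≡⟨ cong (n ^ (r * n) *_) (expTrunc-zero n N) ⟩
    n ^ (r * n) * (N ! * n ^ N)
  ≡⟨ *-assoc (n ^ (r * n)) (N !) (n ^ N) ⟨
    n ^ (r * n) * N ! * n ^ N ∎)
  where open ≤-Reasoning

-- With n = 1 + a + d:  C^n ≤ e^{rd} ≤ (n/(1 + a))^{rn}  by expScaled-bound; take n-th roots.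
ExpAtLeast⇒C·a^r≤n^r : ∀ C r a d → ExpAtLeast (r * d) (C ^ (suc a + d)) → C * suc a ^ r ≤ (suc a + d) ^ r
ExpAtLeast⇒C·a^r≤n^r C r a d e^rd≥C^n with C * suc a ^ r ≤? (suc a + d) ^ r
... | yes C·a^r≤n^r = C·a^r≤n^r
... | no  C·a^r≰n^r with e^rd≥C^n (suc a ^ (r * (suc a + d))) (m^n>0 (suc a) (r * (suc a + d)))
...   | N , truncation-large = contradiction truncation-small (<⇒≱ truncation-large)
  where
  open ≤-Reasoning
  n = suc a + d
  q = suc a ^ (r * n)
  n^rn<q·C^n : n ^ (r * n) < q * C ^ n
  n^rn<q·C^n = begin-strict
    n ^ (r * n)         ≡⟨ ^-*-assoc n r n ⟨
    (n ^ r) ^ n         <⟨ ^-monoˡ-< n (≰⇒> C·a^r≰n^r) ⟩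
    (C * suc a ^ r) ^ n ≡⟨ ^-distribʳ-* C (suc a ^ r) n ⟩
    C ^ n * (suc a ^ r) ^ n ≡⟨ cong (C ^ n *_) (^-*-assoc (suc a) r n) ⟩
    C ^ n * q           ≡⟨ *-comm (C ^ n) q ⟩
    q * C ^ n           ∎
  truncation-small : q * expScaled (r * d) N + N ! ≤ q * C ^ n * N !
  truncation-small = begin
    q * expScaled (r * d) N + N ! ≤⟨ +-monoˡ-≤ (N !) (expScaled-bound r N refl) ⟩
    n ^ (r * n) * N ! + N !       ≡⟨ +-comm _ (N !) ⟩
    suc (n ^ (r * n)) * N !       ≤⟨ *-monoˡ-≤ (N !) n^rn<q·C^n ⟩
    q * C ^ n * N !               ∎

χ : Bool → ℕ
χ true  = 1
χ false = 0

χ-∧ : ∀ a b → χ (a ∧ b) ≡ χ a * χ b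
χ-∧ true  b = sym (+-identityʳ (χ b))
χ-∧ false b = refl

χ-∨-≤ : ∀ a b → χ (a ∨ b) ≤ χ a + χ b
χ-∨-≤ true  b = s≤s z≤n
χ-∨-≤ false b = ≤-refl

χ-+-χ-not : ∀ b → χ b + χ (not b) ≡ 1
χ-+-χ-not true  = refl
χ-+-χ-not false = refl

∑ : {A : Set} → List A → (A → ℕ) → ℕ
∑ []       f = 0
∑ (x ∷ xs) f = f x + ∑ xs f

syntax ∑ xs (λ x → e) = ∑[ x ∈ xs ] e

module _ {A : Set} where

  ∑-++ : ∀ (xs ys : List A) f → ∑ (xs ++ ys) f ≡ ∑ xs f + ∑ ys f
  ∑-++ []       ys f = refl
  ∑-++ (x ∷ xs) ys f = trans (cong (f x +_) (∑-++ xs ys f)) (sym (+-assoc (f x) _ _))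

  ∑-cong : ∀ (xs : List A) {f g} → (∀ x → f x ≡ g x) → ∑ xs f ≡ ∑ xs g
  ∑-cong []       f≗g = refl
  ∑-cong (x ∷ xs) f≗g = cong₂ _+_ (f≗g x) (∑-cong xs f≗g)

  ∑-mono-≤-on : ∀ (xs : List A) {f g} → (∀ {x} → x ∈ xs → f x ≤ g x) → ∑ xs f ≤ ∑ xs g
  ∑-mono-≤-on []       f≤g = z≤n
  ∑-mono-≤-on (x ∷ xs) f≤g = +-mono-≤ (f≤g (here refl)) (∑-mono-≤-on xs (f≤g ∘ there))

  ∑-mono-≤ : ∀ (xs : List A) {f g} → (∀ x → f x ≤ g x) → ∑ xs f ≤ ∑ xs g
  ∑-mono-≤ xs f≤g = ∑-mono-≤-on xs (λ {x} _ → f≤g x)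

  ∑-mono-< : ∀ {xs : List A} {x} f g → x ∈ xs → (∀ y → f y ≤ g y) → f x < g x → ∑ xs f < ∑ xs g
  ∑-mono-< {y ∷ xs} f g (here refl) f≤g fx<gx = +-mono-<-≤ fx<gx (∑-mono-≤ xs f≤g)
  ∑-mono-< {y ∷ xs} f g (there x∈xs) f≤g fx<gx = +-mono-≤-< (f≤g y) (∑-mono-< f g x∈xs f≤g fx<gx)

  ∈⇒≤∑ : ∀ {xs : List A} {x} f → x ∈ xs → f x ≤ ∑ xs f
  ∈⇒≤∑ {y ∷ xs} f (here refl)  = m≤m+n (f y) _
  ∈⇒≤∑ {y ∷ xs} f (there x∈xs) = ≤-trans (∈⇒≤∑ f x∈xs) (m≤n+m _ (f y))

  ∑-distrib-+ : ∀ (xs : List A) f g → ∑[ x ∈ xs ] (f x + g x) ≡ ∑ xs f + ∑ xs g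
  ∑-distrib-+ []       f g = refl
  ∑-distrib-+ (x ∷ xs) f g = trans (cong (f x + g x +_) (∑-distrib-+ xs f g)) (interchange (f x) (g x) _ _)

  ∑-*ˡ : ∀ (xs : List A) c f → ∑[ x ∈ xs ] (c * f x) ≡ c * ∑ xs f
  ∑-*ˡ []       c f = sym (*-zeroʳ c)
  ∑-*ˡ (x ∷ xs) c f = trans (cong (c * f x +_) (∑-*ˡ xs c f)) (sym (*-distribˡ-+ c (f x) _))

  ∑-*ʳ : ∀ (xs : List A) c f → ∑[ x ∈ xs ] (f x * c) ≡ ∑ xs f * c
  ∑-*ʳ xs c f = trans (∑-cong xs (λ x → *-comm (f x) c)) (trans (∑-*ˡ xs c f) (*-comm c _))

  ∑-const : ∀ (xs : List A) c → ∑[ _ ∈ xs ] c ≡ length xs * c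
  ∑-const []       c = refl
  ∑-const (x ∷ xs) c = cong (c +_) (∑-const xs c)

  ∑-map : ∀ {B : Set} (h : B → A) (xs : List B) f → ∑ (map h xs) f ≡ ∑ xs (f ∘ h)
  ∑-map h []       f = refl
  ∑-map h (x ∷ xs) f = cong (f (h x) +_) (∑-map h xs f)

  ∑-concatMap : ∀ {B : Set} (g : B → List A) (xs : List B) f →
    ∑ (concatMap g xs) f ≡ ∑[ x ∈ xs ] ∑ (g x) f
  ∑-concatMap g []       f = refl
  ∑-concatMap g (x ∷ xs) f =
    trans (∑-++ (g x) (concat (map g xs)) f) (cong (∑ (g x) f +_) (∑-concatMap g xs f))

  length-filterᵇ : ∀ p (xs : List A) → length (filterᵇ p xs) ≡ ∑[ x ∈ xs ] χ (p x)
  length-filterᵇ p []       = refl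
  length-filterᵇ p (x ∷ xs) with p x
  ... | true  = cong suc (length-filterᵇ p xs)
  ... | false = length-filterᵇ p xs

∑-zero : ∀ {A : Set} (xs : List A) → ∑[ _ ∈ xs ] 0 ≡ 0
∑-zero xs = trans (∑-const xs 0) (*-zeroʳ (length xs))

∑-comm : ∀ {A B : Set} (xs : List A) (ys : List B) (f : A → B → ℕ) →
  ∑[ x ∈ xs ] ∑[ y ∈ ys ] f x y ≡ ∑[ y ∈ ys ] ∑[ x ∈ xs ] f x y
∑-comm []       ys f = sym (∑-zero ys)
∑-comm (x ∷ xs) ys f =
  trans (cong (∑ ys (f x) +_) (∑-comm xs ys f)) (sym (∑-distrib-+ ys (f x) (λ y → ∑[ x ∈ xs ] f x y)))

∑-applyUpTo : ∀ {A : Set} m (h : ℕ → A) g → ∑ (applyUpTo h m) g ≡ ∑ (upTo m) (g ∘ h)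
∑-applyUpTo zero    h g = refl
∑-applyUpTo (suc m) h g =
  cong (g (h 0) +_) (trans (∑-applyUpTo m (h ∘ suc) g) (sym (∑-applyUpTo m suc (g ∘ h))))

∑-upTo-suc : ∀ m g → ∑ (upTo (suc m)) g ≡ g 0 + ∑ (upTo m) (g ∘ suc)
∑-upTo-suc m g = cong (g 0 +_) (∑-applyUpTo m suc g)

∑-tabulate : ∀ {A : Set} m (f : Fin m → A) g → ∑ (tabulate f) g ≡ ∑ (allFin m) (g ∘ f)
∑-tabulate zero    f g = refl
∑-tabulate (suc m) f g =
  cong (g (f fzero) +_) (trans (∑-tabulate m (f ∘ fsuc) g) (sym (∑-tabulate m fsuc (g ∘ f))))

∑-allFin-const : ∀ n c → ∑[ _ ∈ allFin n ] c ≡ n * c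
∑-allFin-const n c = trans (∑-const (allFin n) c) (cong (_* c) (length-tabulate {n = n} id))

module _ {A : Set} where

  all-∈ : ∀ (p : A → Bool) {x xs} → all p xs ≡ true → x ∈ xs → p x ≡ true
  all-∈ p {xs = y ∷ xs} eq x∈xs with p y in py
  all-∈ p eq (here refl)  | true = py
  all-∈ p eq (there x∈xs) | true = all-∈ p eq x∈xs

  all-++ : ∀ (p : A → Bool) xs ys → all p (xs ++ ys) ≡ (all p xs ∧ all p ys)
  all-++ p []       ys = refl
  all-++ p (x ∷ xs) ys rewrite all-++ p xs ys = sym (∧-assoc (p x) (all p xs) (all p ys))

  all-++⁻ʳ : ∀ (p : A → Bool) xs {ys} → all p (xs ++ ys) ≡ true → all p ys ≡ true
  all-++⁻ʳ p xs {ys} eq = ∧-conicalʳ (all p xs) (all p ys) (trans (sym (all-++ p xs ys)) eq)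

  ∈⇒all : ∀ (p : A → Bool) xs → (∀ {x} → x ∈ xs → p x ≡ true) → all p xs ≡ true
  ∈⇒all p []       _  = refl
  ∈⇒all p (y ∷ xs) ∈⇒p rewrite ∈⇒p (here refl) = ∈⇒all p xs (∈⇒p ∘ there)

  all-∈-false : ∀ (p : A → Bool) {x xs} → x ∈ xs → p x ≡ false → all p xs ≡ false
  all-∈-false p {xs = y ∷ xs} (here refl)  py = cong (_∧ all p xs) py
  all-∈-false p {xs = y ∷ xs} (there x∈xs) px with p y
  ... | true  = all-∈-false p x∈xs px
  ... | false = refl

  all-false⇒∃ : ∀ (p : A → Bool) xs → all p xs ≡ false → Σ[ x ∈ A ] x ∈ xs × p x ≡ false
  all-false⇒∃ p (y ∷ xs) eq with p y in py
  ... | false = y , here refl , py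
  ... | true with all-false⇒∃ p xs eq
  ...   | x , x∈xs , px = x , there x∈xs , px

  any-true⇒∃ : ∀ (p : A → Bool) xs → any p xs ≡ true → Σ[ x ∈ A ] x ∈ xs × p x ≡ true
  any-true⇒∃ p (y ∷ xs) eq with p y in py
  ... | true  = y , here refl , py
  ... | false with any-true⇒∃ p xs eq
  ...   | x , x∈xs , px = x , there x∈xs , px

  any-false⇒all-not : ∀ (p : A → Bool) xs → any p xs ≡ false → all (not ∘ p) xs ≡ true
  any-false⇒all-not p []       _  = refl
  any-false⇒all-not p (y ∷ xs) eq with p y
  ... | false = any-false⇒all-not p xs eq

  χ-all-mono : ∀ (p q : A → Bool) xs → (∀ y → p y ≡ true → q y ≡ true) →
    χ (all p xs) ≤ χ (all q xs)
  χ-all-mono p q []       _   = ≤-refl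
  χ-all-mono p q (y ∷ xs) p⇒q with p y in py
  ... | false = z≤n
  ... | true rewrite p⇒q y py = χ-all-mono p q xs p⇒q

rot : ∀ {A : Set} → List A → List A
rot []       = []
rot (x ∷ xs) = xs ++ [ x ]

rotN : ∀ {A : Set} → ℕ → List A → List A
rotN zero    xs = xs
rotN (suc j) xs = rotN j (rot xs)

module _ {A : Set} where

  all-rot : ∀ (p : A → Bool) xs → all p (rot xs) ≡ all p xs
  all-rot p []       = refl
  all-rot p (x ∷ xs) = trans (all-++ p xs [ x ])
    (trans (cong (all p xs ∧_) (∧-comm (p x) true)) (∧-comm (all p xs) (p x)))

  all-rotN : ∀ (p : A → Bool) j xs → all p (rotN j xs) ≡ all p xs
  all-rotN p zero    xs = refl
  all-rotN p (suc j) xs = trans (all-rotN p j (rot xs)) (all-rot p xs)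

  length-snoc : ∀ xs (x : A) → length (xs ++ [ x ]) ≡ suc (length xs)
  length-snoc xs x = trans (length-++ xs) (+-comm (length xs) 1)

  length-rot : ∀ (xs : List A) → length (rot xs) ≡ length xs
  length-rot []       = refl
  length-rot (x ∷ xs) = length-snoc xs x

  length-rotN : ∀ j (xs : List A) → length (rotN j xs) ≡ length xs
  length-rotN zero    xs = refl
  length-rotN (suc j) xs = trans (length-rotN j (rot xs)) (length-rot xs)

  rotN-++ : ∀ (xs ys : List A) → rotN (length xs) (xs ++ ys) ≡ ys ++ xs
  rotN-++ []       ys = sym (++-identityʳ ys)
  rotN-++ (x ∷ xs) ys = begin
      rotN (length xs) ((xs ++ ys) ++ [ x ]) ≡⟨ cong (rotN (length xs)) (++-assoc xs ys [ x ]) ⟩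
      rotN (length xs) (xs ++ ys ++ [ x ])   ≡⟨ rotN-++ xs (ys ++ [ x ]) ⟩
      (ys ++ [ x ]) ++ xs                    ≡⟨ ++-assoc ys [ x ] xs ⟩
      ys ++ x ∷ xs                           ∎
    where open ≡-Reasoning

  last : A → List A → A
  last x []       = x
  last x (y ∷ ys) = last y ys

  last-++ : ∀ x xs y ys → last x (xs ++ y ∷ ys) ≡ last y ys
  last-++ x []       y ys = refl
  last-++ x (z ∷ xs) y ys = last-++ z xs y ys

  last∈ : ∀ x xs → last x xs ∈ x ∷ xs
  last∈ x []       = here refl
  last∈ x (y ∷ xs) = there (last∈ y xs)

  last-split : ∀ {x xs} pre y post → x ∷ xs ≡ pre ++ y ∷ post → last x xs ≡ last y post
  last-split []        y post refl = refl
  last-split (p ∷ pre) y post refl = last-++ p pre y post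

module _ {n : ℕ} where

  ∑-allLists-zero : ∀ f → ∑ (allLists n 0) f ≡ f []
  ∑-allLists-zero f = +-identityʳ (f [])

  ∑-allLists-suc : ∀ ℓ f →
    ∑ (allLists n (suc ℓ)) f ≡ ∑[ x ∈ allFin n ] ∑[ t ∈ allLists n ℓ ] f (x ∷ t)
  ∑-allLists-suc ℓ f = trans (∑-concatMap (λ x → map (x ∷_) (allLists n ℓ)) (allFin n) f)
                             (∑-cong (allFin n) (λ x → ∑-map (x ∷_) (allLists n ℓ) f))

  ∑-allLists-mono-≤ : ∀ ℓ {f g} → (∀ s → length s ≡ ℓ → f s ≤ g s) →
    ∑ (allLists n ℓ) f ≤ ∑ (allLists n ℓ) g
  ∑-allLists-mono-≤ zero    f≤g = +-monoˡ-≤ 0 (f≤g [] refl)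
  ∑-allLists-mono-≤ (suc ℓ) {f} {g} f≤g =
    subst₂ _≤_ (sym (∑-allLists-suc ℓ f)) (sym (∑-allLists-suc ℓ g))
      (∑-mono-≤ (allFin n) (λ x → ∑-allLists-mono-≤ ℓ (λ t |t|≡ℓ → f≤g (x ∷ t) (cong suc |t|≡ℓ))))

  ≤∑-allLists : ∀ ℓ f s → length s ≡ ℓ → f s ≤ ∑ (allLists n ℓ) f
  ≤∑-allLists zero    f []      _     = m≤m+n (f []) 0
  ≤∑-allLists (suc ℓ) f (x ∷ s) |s|≡ℓ = subst (f (x ∷ s) ≤_) (sym (∑-allLists-suc ℓ f))
    (≤-trans (≤∑-allLists ℓ (λ t → f (x ∷ t)) s (suc-injective |s|≡ℓ))
             (∈⇒≤∑ (λ y → ∑[ t ∈ allLists n ℓ ] f (y ∷ t)) (∈-allFin x)))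

  ∑-allLists-all : ∀ ℓ p → ∑[ s ∈ allLists n ℓ ] χ (all p s) ≡ (∑[ x ∈ allFin n ] χ (p x)) ^ ℓ
  ∑-allLists-all zero    p = refl
  ∑-allLists-all (suc ℓ) p = begin
      ∑[ s ∈ allLists n (suc ℓ) ] χ (all p s)
    ≡⟨ ∑-allLists-suc ℓ _ ⟩
      ∑[ x ∈ allFin n ] ∑[ t ∈ allLists n ℓ ] χ (p x ∧ all p t)
    ≡⟨ ∑-cong (allFin n) (λ x → trans (∑-cong (allLists n ℓ) (λ t → χ-∧ (p x) (all p t)))
                                      (∑-*ˡ (allLists n ℓ) (χ (p x)) _)) ⟩
      ∑[ x ∈ allFin n ] (χ (p x) * ∑[ t ∈ allLists n ℓ ] χ (all p t))
    ≡⟨ ∑-*ʳ (allFin n) _ (χ ∘ p) ⟩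
      (∑[ x ∈ allFin n ] χ (p x)) * ∑[ t ∈ allLists n ℓ ] χ (all p t)
    ≡⟨ cong ((∑[ x ∈ allFin n ] χ (p x)) *_) (∑-allLists-all ℓ p) ⟩
      (∑[ x ∈ allFin n ] χ (p x)) ^ suc ℓ ∎
    where open ≡-Reasoning

  ∑-allLists-1 : ∀ ℓ → ∑[ _ ∈ allLists n ℓ ] 1 ≡ n ^ ℓ
  ∑-allLists-1 zero    = refl
  ∑-allLists-1 (suc ℓ) = trans (∑-allLists-suc ℓ (λ _ → 1))
    (trans (∑-cong (allFin n) (λ _ → ∑-allLists-1 ℓ)) (∑-allFin-const n (n ^ ℓ)))

  ∑-allLists-snoc : ∀ ℓ f →
    ∑ (allLists n (suc ℓ)) f ≡ ∑[ t ∈ allLists n ℓ ] ∑[ x ∈ allFin n ] f (t ++ [ x ])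
  ∑-allLists-snoc zero f =
    trans (∑-allLists-suc 0 f) (trans (∑-cong (allFin n) (λ x → ∑-allLists-zero (λ t → f (x ∷ t))))
                                      (sym (∑-allLists-zero (λ t → ∑[ x ∈ allFin n ] f (t ++ [ x ])))))
  ∑-allLists-snoc (suc ℓ) f = begin
      ∑ (allLists n (suc (suc ℓ))) f
    ≡⟨ ∑-allLists-suc (suc ℓ) f ⟩
      ∑[ y ∈ allFin n ] ∑[ t ∈ allLists n (suc ℓ) ] f (y ∷ t)
    ≡⟨ ∑-cong (allFin n) (λ y → ∑-allLists-snoc ℓ (λ t → f (y ∷ t))) ⟩
      ∑[ y ∈ allFin n ] ∑[ t ∈ allLists n ℓ ] ∑[ x ∈ allFin n ] f (y ∷ t ++ [ x ])
    ≡⟨ ∑-allLists-suc ℓ (λ t → ∑[ x ∈ allFin n ] f (t ++ [ x ])) ⟨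
      ∑[ t ∈ allLists n (suc ℓ) ] ∑[ x ∈ allFin n ] f (t ++ [ x ]) ∎
    where open ≡-Reasoning

  ∑-allLists-rot : ∀ ℓ f → ∑ (allLists n ℓ) (f ∘ rot) ≡ ∑ (allLists n ℓ) f
  ∑-allLists-rot zero    f = refl
  ∑-allLists-rot (suc ℓ) f = begin
      ∑ (allLists n (suc ℓ)) (f ∘ rot)
    ≡⟨ ∑-allLists-suc ℓ (f ∘ rot) ⟩
      ∑[ x ∈ allFin n ] ∑[ t ∈ allLists n ℓ ] f (t ++ [ x ])
    ≡⟨ ∑-comm (allFin n) (allLists n ℓ) (λ x t → f (t ++ [ x ])) ⟩
      ∑[ t ∈ allLists n ℓ ] ∑[ x ∈ allFin n ] f (t ++ [ x ])
    ≡⟨ ∑-allLists-snoc ℓ f ⟨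
      ∑ (allLists n (suc ℓ)) f ∎
    where open ≡-Reasoning

  ∑-allLists-rotN : ∀ ℓ j f → ∑ (allLists n ℓ) (f ∘ rotN j) ≡ ∑ (allLists n ℓ) f
  ∑-allLists-rotN ℓ zero    f = refl
  ∑-allLists-rotN ℓ (suc j) f = trans (∑-allLists-rot ℓ (f ∘ rotN j)) (∑-allLists-rotN ℓ j f)

module _ {n : ℕ} where

  infix 7 _≟ᵇ_ _≤ᵇ_ _∈ᵇ_ _⊆ᵇ_

  _≟ᵇ_ : Fin n → Fin n → Bool
  x ≟ᵇ y = ⌊ x Fin.≟ y ⌋

  _≤ᵇ_ : Fin n → Fin n → Bool
  x ≤ᵇ y = ⌊ x Fin.≤? y ⌋

  _∈ᵇ_ : Fin n → List (Fin n) → Bool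
  x ∈ᵇ xs = any (x ≟ᵇ_) xs

  _⊆ᵇ_ : List (Fin n) → List (Fin n) → Bool
  xs ⊆ᵇ ys = all (_∈ᵇ ys) xs

  ≟ᵇ-refl : ∀ x → (x ≟ᵇ x) ≡ true
  ≟ᵇ-refl x with x Fin.≟ x
  ... | yes _   = refl
  ... | no  x≢x = contradiction refl x≢x

  ≟ᵇ⇒≡ : ∀ {x y} → (x ≟ᵇ y) ≡ true → x ≡ y
  ≟ᵇ⇒≡ {x} {y} eq with x Fin.≟ y
  ... | yes x≡y = x≡y

  ≟ᵇ-sym : ∀ x y → (x ≟ᵇ y) ≡ (y ≟ᵇ x)
  ≟ᵇ-sym x y with x Fin.≟ y | y Fin.≟ x
  ... | yes _   | yes _   = refl
  ... | no  _   | no  _   = refl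
  ... | yes x≡y | no  y≢x = contradiction (sym x≡y) y≢x
  ... | no  x≢y | yes y≡x = contradiction (sym y≡x) x≢y

  ≤ᵇ⇒≤ : ∀ {x y} → (x ≤ᵇ y) ≡ true → x ≤ᶠ y
  ≤ᵇ⇒≤ {x} {y} eq with x Fin.≤? y
  ... | yes x≤y = x≤y

  ≤⇒≤ᵇ : ∀ {x y : Fin n} → x ≤ᶠ y → x ≤ᵇ y ≡ true
  ≤⇒≤ᵇ {x} {y} x≤y with x Fin.≤? y
  ... | yes _   = refl
  ... | no  x≰y = contradiction x≤y x≰y

  ∈ᵇ⇒∈ : ∀ {x} xs → (x ∈ᵇ xs) ≡ true → x ∈ xs
  ∈ᵇ⇒∈ {x} (y ∷ xs) eq with x ≟ᵇ y in x≟y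
  ... | true  = here (≟ᵇ⇒≡ x≟y)
  ... | false = there (∈ᵇ⇒∈ xs eq)

  ∈⇒∈ᵇ : ∀ {x xs} → x ∈ xs → (x ∈ᵇ xs) ≡ true
  ∈⇒∈ᵇ {x} (here refl) rewrite ≟ᵇ-refl x = refl
  ∈⇒∈ᵇ {x} {y ∷ _} (there x∈xs) rewrite ∈⇒∈ᵇ x∈xs with x ≟ᵇ y
  ... | true  = refl
  ... | false = refl

  ∈ᵇ-++ : ∀ x xs ys → (x ∈ᵇ (xs ++ ys)) ≡ (x ∈ᵇ xs ∨ x ∈ᵇ ys)
  ∈ᵇ-++ x []       ys = refl
  ∈ᵇ-++ x (y ∷ xs) ys rewrite ∈ᵇ-++ x xs ys with x ≟ᵇ y
  ... | true  = refl
  ... | false = refl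

  ⊆ᵇ⇒⊆ : ∀ {xs ys : List (Fin n)} {x} → xs ⊆ᵇ ys ≡ true → x ∈ xs → x ∈ ys
  ⊆ᵇ⇒⊆ {ys = ys} xs⊆ys x∈xs = ∈ᵇ⇒∈ ys (all-∈ (_∈ᵇ ys) xs⊆ys x∈xs)

  distinct-head : ∀ x xs → distinctᵇ (x ∷ xs) ≡ true → (x ∈ᵇ xs) ≡ false
  distinct-head x xs eq with x ∈ᵇ xs
  ... | false = refl

  distinct-tail : ∀ x xs → distinctᵇ (x ∷ xs) ≡ true → distinctᵇ xs ≡ true
  distinct-tail x xs = ∧-conicalʳ (not (x ∈ᵇ xs)) (distinctᵇ xs)

  distinct-++ʳ : ∀ xs {ys} → distinctᵇ (xs ++ ys) ≡ true → distinctᵇ ys ≡ true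
  distinct-++ʳ []       eq = eq
  distinct-++ʳ (x ∷ xs) {ys} eq = distinct-++ʳ xs (distinct-tail x (xs ++ ys) eq)

  distinct-snoc : ∀ xs x → distinctᵇ (xs ++ [ x ]) ≡ (not (x ∈ᵇ xs) ∧ distinctᵇ xs)
  distinct-snoc []       x = refl
  distinct-snoc (y ∷ xs) x = begin
      not (y ∈ᵇ (xs ++ [ x ])) ∧ distinctᵇ (xs ++ [ x ])
    ≡⟨ cong₂ (λ a b → not a ∧ b) (∈ᵇ-++ y xs [ x ]) (distinct-snoc xs x) ⟩
      not (y ∈ᵇ xs ∨ (y ≟ᵇ x ∨ false)) ∧ (not (x ∈ᵇ xs) ∧ distinctᵇ xs)
    ≡⟨ cong (λ b → not (y ∈ᵇ xs ∨ b) ∧ (not (x ∈ᵇ xs) ∧ distinctᵇ xs))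
            (trans (∨-identityʳ (y ≟ᵇ x)) (≟ᵇ-sym y x)) ⟩
      not (y ∈ᵇ xs ∨ x ≟ᵇ y) ∧ (not (x ∈ᵇ xs) ∧ distinctᵇ xs)
    ≡⟨ exchange (y ∈ᵇ xs) (x ≟ᵇ y) (x ∈ᵇ xs) (distinctᵇ xs) ⟩
      not (x ≟ᵇ y ∨ x ∈ᵇ xs) ∧ (not (y ∈ᵇ xs) ∧ distinctᵇ xs) ∎
    where
    open ≡-Reasoning
    exchange : ∀ a b c d → (not (a ∨ b) ∧ (not c ∧ d)) ≡ (not (b ∨ c) ∧ (not a ∧ d))
    exchange true  true  c     d = refl
    exchange true  false true  d = refl
    exchange true  false false d = refl
    exchange false true  c     d = refl
    exchange false false true  d = refl
    exchange false false false d = refl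

  distinct-rot : ∀ xs → distinctᵇ (rot xs) ≡ distinctᵇ xs
  distinct-rot []       = refl
  distinct-rot (x ∷ xs) = distinct-snoc xs x

  ∉-filterᵇ : ∀ (p : Fin n → Bool) {x} xs → x ∈ᵇ xs ≡ false → x ∈ᵇ filterᵇ p xs ≡ false
  ∉-filterᵇ p []                x∉xs = refl
  ∉-filterᵇ p {x} (y ∷ xs) x∉xs with p y
  ... | true  = cong₂ _∨_ (∨-conicalˡ (x ≟ᵇ y) _ x∉xs)
                          (∉-filterᵇ p xs (∨-conicalʳ (x ≟ᵇ y) _ x∉xs))
  ... | false = ∉-filterᵇ p xs (∨-conicalʳ (x ≟ᵇ y) _ x∉xs)

  distinct-filterᵇ : ∀ (p : Fin n → Bool) xs → distinctᵇ xs ≡ true → distinctᵇ (filterᵇ p xs) ≡ true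
  distinct-filterᵇ p []       _        = refl
  distinct-filterᵇ p (y ∷ xs) distinct with p y
  ... | true  rewrite ∉-filterᵇ p xs (distinct-head y xs distinct) =
          distinct-filterᵇ p xs (distinct-tail y xs distinct)
  ... | false = distinct-filterᵇ p xs (distinct-tail y xs distinct)

fsuc-≟ᵇ : ∀ {m} (x y : Fin m) → (fsuc x ≟ᵇ fsuc y) ≡ (x ≟ᵇ y)
fsuc-≟ᵇ x y with x Fin.≟ y
... | yes _ = refl
... | no  _ = refl

∑-≟ᵇ : ∀ {m} (y : Fin m) → ∑[ x ∈ allFin m ] χ (x ≟ᵇ y) ≡ 1
∑-≟ᵇ {suc m} fzero    = cong suc (trans (∑-tabulate m fsuc _) (∑-zero (allFin m)))
∑-≟ᵇ {suc m} (fsuc y) = trans (∑-tabulate m fsuc _)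
                              (trans (∑-cong (allFin m) (λ x → cong χ (fsuc-≟ᵇ x y))) (∑-≟ᵇ y))

module _ {n : ℕ} where

  ∑-∈ᵇ-≤-length : ∀ (xs : List (Fin n)) → ∑[ x ∈ allFin n ] χ (x ∈ᵇ xs) ≤ length xs
  ∑-∈ᵇ-≤-length []       = ≤-reflexive (∑-zero (allFin n))
  ∑-∈ᵇ-≤-length (y ∷ xs) = begin
      ∑[ x ∈ allFin n ] χ (x ≟ᵇ y ∨ x ∈ᵇ xs)
    ≤⟨ ∑-mono-≤ (allFin n) (λ x → χ-∨-≤ (x ≟ᵇ y) (x ∈ᵇ xs)) ⟩
      ∑[ x ∈ allFin n ] (χ (x ≟ᵇ y) + χ (x ∈ᵇ xs))
    ≡⟨ ∑-distrib-+ (allFin n) _ _ ⟩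
      ∑[ x ∈ allFin n ] χ (x ≟ᵇ y) + ∑[ x ∈ allFin n ] χ (x ∈ᵇ xs)
    ≤⟨ +-mono-≤ (≤-reflexive (∑-≟ᵇ y)) (∑-∈ᵇ-≤-length xs) ⟩
      suc (length xs) ∎
    where open ≤-Reasoning

  length≤∑-∈ᵇ : ∀ (xs : List (Fin n)) → distinctᵇ xs ≡ true →
    length xs ≤ ∑[ x ∈ allFin n ] χ (x ∈ᵇ xs)
  length≤∑-∈ᵇ []       _        = z≤n
  length≤∑-∈ᵇ (y ∷ xs) distinct = begin
      suc (length xs)
    ≤⟨ +-mono-≤ (≤-reflexive (sym (∑-≟ᵇ y))) (length≤∑-∈ᵇ xs (distinct-tail y xs distinct)) ⟩
      ∑[ x ∈ allFin n ] χ (x ≟ᵇ y) + ∑[ x ∈ allFin n ] χ (x ∈ᵇ xs)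
    ≡⟨ ∑-distrib-+ (allFin n) _ _ ⟨
      ∑[ x ∈ allFin n ] (χ (x ≟ᵇ y) + χ (x ∈ᵇ xs))
    ≤⟨ ∑-mono-≤ (allFin n) disjoint ⟩
      ∑[ x ∈ allFin n ] χ (x ≟ᵇ y ∨ x ∈ᵇ xs) ∎
    where
    open ≤-Reasoning
    disjoint : ∀ x → χ (x ≟ᵇ y) + χ (x ∈ᵇ xs) ≤ χ (x ≟ᵇ y ∨ x ∈ᵇ xs)
    disjoint x with x ≟ᵇ y in x≟y
    ... | false = ≤-refl
    ... | true rewrite ≟ᵇ⇒≡ x≟y | distinct-head y xs distinct = ≤-refl

  distinct-⊆ᵇ⇒length-≤ : ∀ {xs ys : List (Fin n)} → distinctᵇ xs ≡ true → xs ⊆ᵇ ys ≡ true →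
    length xs ≤ length ys
  distinct-⊆ᵇ⇒length-≤ {xs} {ys} distinct xs⊆ys = begin
    length xs                          ≤⟨ length≤∑-∈ᵇ xs distinct ⟩
    ∑[ x ∈ allFin n ] χ (x ∈ᵇ xs)      ≤⟨ ∑-mono-≤ (allFin n) ∈ᵇ-mono ⟩
    ∑[ x ∈ allFin n ] χ (x ∈ᵇ ys)      ≤⟨ ∑-∈ᵇ-≤-length ys ⟩
    length ys                          ∎
    where
    open ≤-Reasoning
    ∈ᵇ-mono : ∀ x → χ (x ∈ᵇ xs) ≤ χ (x ∈ᵇ ys)
    ∈ᵇ-mono x with x ∈ᵇ xs in x∈xs
    ... | false = z≤n
    ... | true rewrite ∈⇒∈ᵇ (⊆ᵇ⇒⊆ {xs = xs} {ys = ys} xs⊆ys (∈ᵇ⇒∈ xs x∈xs)) = ≤-refl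

-- Cycles and canonical rotations

module _ {n : ℕ} where

  open import Data.List.Extrema (Fin.≤-totalOrder n) using (min; min≤⊤; min≤xs; argmin-sel)

  -- Among the rotations of a cycle sequence we count only the one starting at its least vertex.
  canonicalᵇ : List (Fin n) → Bool
  canonicalᵇ []       = false
  canonicalᵇ (x ∷ xs) = all (x ≤ᵇ_) xs

  split-at : ∀ (xs : List (Fin n)) i → i < length xs →
    Σ[ pre ∈ List (Fin n) ] Σ[ y ∈ Fin n ] Σ[ post ∈ List (Fin n) ]
      xs ≡ pre ++ y ∷ post × length pre ≡ i
  split-at (y ∷ xs) zero    _           = [] , y , xs , refl , refl
  split-at (x ∷ xs) (suc i) (s≤s i<|xs|) with split-at xs i i<|xs|
  ... | pre , y , post , refl , refl = x ∷ pre , y , post , refl , refl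

  -- A canonical list starts with its minimum, and in a distinct list no other entry equals it.
  rotN-not-canonical : ∀ x xs i → distinctᵇ (x ∷ xs) ≡ true → canonicalᵇ (x ∷ xs) ≡ true →
    i < length xs → canonicalᵇ (rotN (suc i) (x ∷ xs)) ≡ false
  rotN-not-canonical x xs i distinct canonical i<|xs| with split-at xs i i<|xs|
  ... | pre , y , post , refl , refl
    with canonicalᵇ (rotN (suc (length pre)) (x ∷ pre ++ y ∷ post)) in canonical′
  ...   | false = refl
  ...   | true  =
    contradiction (trans (sym (∈⇒∈ᵇ x∈xs)) (distinct-head x (pre ++ y ∷ post) distinct)) (λ ())
    where
    y-canonical : all (y ≤ᵇ_) (post ++ x ∷ pre) ≡ true
    y-canonical = subst (λ c → canonicalᵇ c ≡ true) (rotN-++ (x ∷ pre) (y ∷ post)) canonical′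
    x∈xs : x ∈ pre ++ y ∷ post
    x∈xs = ∈-++⁺ʳ pre (here (Fin.≤-antisym
      (≤ᵇ⇒≤ (all-∈ (x ≤ᵇ_) canonical (∈-++⁺ʳ pre (here refl))))
      (≤ᵇ⇒≤ (all-∈ (y ≤ᵇ_) y-canonical (∈-++⁺ʳ post (here refl))))))

  ∑-canonical-rotN-≤1 : ∀ m xs → distinctᵇ xs ≡ true → m ≤ length xs →
    ∑[ j ∈ upTo m ] χ (canonicalᵇ (rotN j xs)) ≤ 1
  ∑-canonical-rotN-≤1 zero    xs       _        _           = z≤n
  ∑-canonical-rotN-≤1 (suc m) (x ∷ xs) distinct (s≤s m≤|xs|)
    rewrite ∑-upTo-suc m (λ j → χ (canonicalᵇ (rotN j (x ∷ xs)))) with canonicalᵇ (x ∷ xs) in canonical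
  ... | true  =
    +-monoʳ-≤ 1 (≤-trans (∑-mono-≤-on (upTo m) later-rotations) (≤-reflexive (∑-zero (upTo m))))
    where
    later-rotations : ∀ {j} → j ∈ upTo m → χ (canonicalᵇ (rotN (suc j) (x ∷ xs))) ≤ 0
    later-rotations j∈ = ≤-reflexive (cong χ (rotN-not-canonical x xs _ distinct canonical
                                                 (≤-trans (∈-upTo⁻ j∈) m≤|xs|)))
  ... | false = ∑-canonical-rotN-≤1 m (rot (x ∷ xs)) (trans (distinct-rot (x ∷ xs)) distinct)
                  (≤-trans (m≤n⇒m≤1+n m≤|xs|) (≤-reflexive (sym (length-rot (x ∷ xs)))))

  min-∈ : ∀ x xs → min x xs ∈ x ∷ xs
  min-∈ x xs with argmin-sel id x xs
  ... | inj₁ min≡x  = here min≡x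
  ... | inj₂ min∈xs = there min∈xs

  min≤ : ∀ {x xs y} → y ∈ x ∷ xs → min x xs ≤ᶠ y
  min≤ {x} {xs} (here refl)  = min≤⊤ x xs
  min≤ {x} {xs} (there y∈xs) = All.lookup (min≤xs x xs) y∈xs

  canonical-rotation : ∀ x xs → ∃[ j ] canonicalᵇ (rotN j (x ∷ xs)) ≡ true
  canonical-rotation x xs with ∈-∃++ (min-∈ x xs)
  ... | pre , post , x∷xs≡ = length pre , subst (λ c → canonicalᵇ c ≡ true) (sym rotated) min-first
    where
    m = min x xs
    rotated : rotN (length pre) (x ∷ xs) ≡ m ∷ post ++ pre
    rotated = trans (cong (rotN (length pre)) x∷xs≡) (rotN-++ pre (m ∷ post))
    moved : ∀ {y} → y ∈ post ++ pre → y ∈ pre ++ m ∷ post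
    moved y∈ with ∈-++⁻ post y∈
    ... | inj₁ y∈post = ∈-++⁺ʳ pre (there y∈post)
    ... | inj₂ y∈pre  = ∈-++⁺ˡ y∈pre
    min-first : all (m ≤ᵇ_) (post ++ pre) ≡ true
    min-first = ∈⇒all (m ≤ᵇ_) (post ++ pre)
      (λ {y} y∈ → ≤⇒≤ᵇ (min≤ (subst (y ∈_) (sym x∷xs≡) (moved y∈))))

module _ {n : ℕ} (D : Digraph n) where

  path-snoc : ∀ x xs y → pathᵇ D (x ∷ xs ++ [ y ]) ≡ (pathᵇ D (x ∷ xs) ∧ adj D (last x xs) y)
  path-snoc x []       y = ∧-comm (adj D x y) true
  path-snoc x (z ∷ xs) y rewrite path-snoc z xs y = sym (∧-assoc (adj D x z) (pathᵇ D (z ∷ xs)) _)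

  path-tail : ∀ x xs → pathᵇ D (x ∷ xs) ≡ true → pathᵇ D xs ≡ true
  path-tail x []       eq = refl
  path-tail x (y ∷ xs) eq with adj D x y
  ... | true = eq

  path-++ʳ : ∀ xs {ys} → pathᵇ D (xs ++ ys) ≡ true → pathᵇ D ys ≡ true
  path-++ʳ []            eq = eq
  path-++ʳ (x ∷ xs) {ys} eq = path-++ʳ xs (path-tail x (xs ++ ys) eq)

  closed-rot : ∀ xs → closedᵇ D (rot xs) ≡ closedᵇ D xs
  closed-rot []           = refl
  closed-rot (x ∷ [])     = refl
  closed-rot (x ∷ y ∷ xs) = begin
      pathᵇ D (y ∷ (xs ++ [ x ]) ++ [ y ])
    ≡⟨ path-snoc y (xs ++ [ x ]) y ⟩
      pathᵇ D (y ∷ xs ++ [ x ]) ∧ adj D (last y (xs ++ [ x ])) y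
    ≡⟨ cong (λ z → pathᵇ D (y ∷ xs ++ [ x ]) ∧ adj D z y) (last-++ y xs x []) ⟩
      pathᵇ D (y ∷ xs ++ [ x ]) ∧ adj D x y
    ≡⟨ ∧-comm (pathᵇ D (y ∷ xs ++ [ x ])) (adj D x y) ⟩
      adj D x y ∧ pathᵇ D (y ∷ xs ++ [ x ]) ∎
    where open ≡-Reasoning

  isCycleᵇ : List (Fin n) → Bool
  isCycleᵇ c = distinctᵇ c ∧ closedᵇ D c

  isCycle-rotN : ∀ j c → isCycleᵇ (rotN j c) ≡ isCycleᵇ c
  isCycle-rotN zero    c = refl
  isCycle-rotN (suc j) c = trans (isCycle-rotN j (rot c)) (cong₂ _∧_ (distinct-rot c) (closed-rot c))

  canonicalCycleᵇ : List (Fin n) → Bool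
  canonicalCycleᵇ c = isCycleᵇ c ∧ canonicalᵇ c

  canonicalCycleCount : ℕ → ℕ
  canonicalCycleCount ℓ = ∑[ c ∈ allLists n ℓ ] χ (canonicalCycleᵇ c)

  -- Each cycle is counted ℓ times in cycleSeqCount (once per rotation) and at most once here.
  ℓ*canonicalCycleCount≤cycleSeqCount : ∀ ℓ → ℓ * canonicalCycleCount ℓ ≤ cycleSeqCount D ℓ
  ℓ*canonicalCycleCount≤cycleSeqCount ℓ = begin
      ℓ * canonicalCycleCount ℓ
    ≡⟨ cong (_* canonicalCycleCount ℓ) (length-upTo ℓ) ⟨
      length (upTo ℓ) * canonicalCycleCount ℓ
    ≡⟨ ∑-const (upTo ℓ) _ ⟨
      ∑[ j ∈ upTo ℓ ] canonicalCycleCount ℓ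
    ≡⟨ ∑-cong (upTo ℓ) (λ j → sym (∑-allLists-rotN ℓ j (χ ∘ canonicalCycleᵇ))) ⟩
      ∑[ j ∈ upTo ℓ ] ∑[ c ∈ allLists n ℓ ] χ (isCycleᵇ (rotN j c) ∧ canonicalᵇ (rotN j c))
    ≡⟨ ∑-cong (upTo ℓ) (λ j → ∑-cong (allLists n ℓ) (λ c →
         trans (cong (λ b → χ (b ∧ canonicalᵇ (rotN j c))) (isCycle-rotN j c)) (χ-∧ (isCycleᵇ c) _))) ⟩
      ∑[ j ∈ upTo ℓ ] ∑[ c ∈ allLists n ℓ ] (χ (isCycleᵇ c) * χ (canonicalᵇ (rotN j c)))
    ≡⟨ ∑-comm (upTo ℓ) (allLists n ℓ) _ ⟩
      ∑[ c ∈ allLists n ℓ ] ∑[ j ∈ upTo ℓ ] (χ (isCycleᵇ c) * χ (canonicalᵇ (rotN j c)))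
    ≡⟨ ∑-cong (allLists n ℓ) (λ c → ∑-*ˡ (upTo ℓ) (χ (isCycleᵇ c)) _) ⟩
      ∑[ c ∈ allLists n ℓ ] (χ (isCycleᵇ c) * ∑[ j ∈ upTo ℓ ] χ (canonicalᵇ (rotN j c)))
    ≤⟨ ∑-allLists-mono-≤ ℓ at-most-one-rotation ⟩
      ∑[ c ∈ allLists n ℓ ] (χ (isCycleᵇ c) * 1)
    ≡⟨ ∑-cong (allLists n ℓ) (λ c → *-identityʳ (χ (isCycleᵇ c))) ⟩
      ∑[ c ∈ allLists n ℓ ] χ (isCycleᵇ c)
    ≡⟨ length-filterᵇ isCycleᵇ (allLists n ℓ) ⟨
      cycleSeqCount D ℓ ∎
    where
    open ≤-Reasoning
    at-most-one-rotation : ∀ c → length c ≡ ℓ →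
      χ (isCycleᵇ c) * ∑[ j ∈ upTo ℓ ] χ (canonicalᵇ (rotN j c)) ≤ χ (isCycleᵇ c) * 1
    at-most-one-rotation c |c|≡ℓ with distinctᵇ c in distinct
    ... | true  =
      *-monoʳ-≤ (χ (closedᵇ D c)) (∑-canonical-rotN-≤1 ℓ c distinct (≤-reflexive (sym |c|≡ℓ)))
    ... | false = z≤n

  canonicalCycleCount≤numCycles : ∀ ℓ → canonicalCycleCount ℓ ≤ numCycles D ℓ
  canonicalCycleCount≤numCycles zero    = z≤n
  canonicalCycleCount≤numCycles (suc m) = begin
      canonicalCycleCount (suc m)
    ≡⟨ m*n/n≡m (canonicalCycleCount (suc m)) (suc m) ⟨
      canonicalCycleCount (suc m) * suc m / suc m
    ≤⟨ /-monoˡ-≤ (suc m) (≤-trans (≤-reflexive (*-comm (canonicalCycleCount (suc m)) (suc m)))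
                                  (ℓ*canonicalCycleCount≤cycleSeqCount (suc m))) ⟩
      cycleSeqCount D (suc m) / suc m ∎
    where open ≤-Reasoning

-- Sequences covering a list of vertices

module _ {n : ℕ} where

  delete : Fin n → List (Fin n) → List (Fin n)
  delete x = filterᵇ (λ y → not (y ≟ᵇ x))

  ⊆ᵇ-∷ : ∀ x ys xs → xs ⊆ᵇ (x ∷ ys) ≡ delete x xs ⊆ᵇ ys
  ⊆ᵇ-∷ x ys []       = refl
  ⊆ᵇ-∷ x ys (y ∷ xs) with y ≟ᵇ x
  ... | true  = ⊆ᵇ-∷ x ys xs
  ... | false = cong (y ∈ᵇ ys ∧_) (⊆ᵇ-∷ x ys xs)

  delete-∉ : ∀ x xs → x ∈ᵇ xs ≡ false → delete x xs ≡ xs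
  delete-∉ x []       _    = refl
  delete-∉ x (y ∷ xs) x∉xs with x ≟ᵇ y in x≟y
  ... | false rewrite ≟ᵇ-sym y x | x≟y = cong (y ∷_) (delete-∉ x xs x∉xs)

  length-delete : ∀ x xs → distinctᵇ xs ≡ true → x ∈ᵇ xs ≡ true →
    suc (length (delete x xs)) ≡ length xs
  length-delete x (y ∷ xs) distinct x∈xs with y ≟ᵇ x in y≟x
  ... | true  = cong (suc ∘ length) (delete-∉ x xs (subst (λ z → z ∈ᵇ xs ≡ false) (≟ᵇ⇒≡ y≟x)
                                                          (distinct-head y xs distinct)))
  ... | false rewrite ≟ᵇ-sym x y | y≟x = cong suc (length-delete x xs (distinct-tail y xs distinct) x∈xs)

  coverCount : ℕ → List (Fin n) → ℕ
  coverCount k c = ∑[ s ∈ allLists n k ] χ (c ⊆ᵇ s)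

  coverCount-suc : ∀ k c → coverCount (suc k) c ≡ ∑[ x ∈ allFin n ] coverCount k (delete x c)
  coverCount-suc k c = trans (∑-allLists-suc k (λ s → χ (c ⊆ᵇ s)))
    (∑-cong (allFin n) (λ x → ∑-cong (allLists n k) (λ t → cong χ (⊆ᵇ-∷ x t c))))

  coverCount-bound : ∀ k c → distinctᵇ c ≡ true → n ^ length c * coverCount k c ≤ k ^ length c * n ^ k
  coverCount-bound zero    []      _ = ≤-refl
  coverCount-bound zero    (y ∷ c) _ = ≤-reflexive (*-zeroʳ (n ^ suc (length c)))
  coverCount-bound (suc k) []      _ = begin
      1 * coverCount (suc k) []              ≡⟨ *-identityˡ _ ⟩
      coverCount (suc k) []                  ≡⟨ coverCount-suc k [] ⟩
      ∑[ _ ∈ allFin n ] coverCount k []      ≡⟨ ∑-allFin-const n _ ⟩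
      n * coverCount k []                    ≤⟨ *-monoʳ-≤ n (subst₂ _≤_ (*-identityˡ _) (*-identityˡ _)
                                                                    (coverCount-bound k [] refl)) ⟩
      n * n ^ k                              ≡⟨ *-identityˡ _ ⟨
      1 * n ^ suc k                          ∎
    where open ≤-Reasoning
  coverCount-bound (suc k) c@(y ∷ c′) distinct = begin
      n ^ ℓ * coverCount (suc k) c
    ≡⟨ cong (n ^ ℓ *_) (coverCount-suc k c) ⟩
      n ^ ℓ * ∑[ x ∈ allFin n ] coverCount k (delete x c)
    ≡⟨ ∑-*ˡ (allFin n) (n ^ ℓ) _ ⟨
      ∑[ x ∈ allFin n ] (n ^ ℓ * coverCount k (delete x c))
    ≤⟨ ∑-mono-≤ (allFin n) deleting ⟩
      ∑[ x ∈ allFin n ] (χ (x ∈ᵇ c) * A + B)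
    ≡⟨ ∑-distrib-+ (allFin n) _ _ ⟩
      ∑[ x ∈ allFin n ] (χ (x ∈ᵇ c) * A) + ∑[ _ ∈ allFin n ] B
    ≡⟨ cong₂ _+_ (∑-*ʳ (allFin n) A _) (∑-allFin-const n B) ⟩
      ∑[ x ∈ allFin n ] χ (x ∈ᵇ c) * A + n * B
    ≤⟨ +-monoˡ-≤ (n * B) (*-monoˡ-≤ A (∑-∈ᵇ-≤-length c)) ⟩
      ℓ * A + n * B
    ≡⟨ lemma ℓ n (k ^ l) (n ^ k) k ⟩
      (ℓ * k ^ l + k * k ^ l) * (n * n ^ k)
    ≤⟨ *-monoˡ-≤ (n * n ^ k) ([1+l]k^l+k^[1+l]≤[1+k]^[1+l] k l) ⟩
      suc k ^ ℓ * n ^ suc k ∎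
    where
    open ≤-Reasoning
    l = length c′
    ℓ = suc l
    A = n * (k ^ l * n ^ k)
    B = k ^ ℓ * n ^ k
    lemma : ∀ L n P N k → L * (n * (P * N)) + n * ((k * P) * N) ≡ (L * P + k * P) * (n * N)
    lemma = solve-∀
    deleting : ∀ x → n ^ ℓ * coverCount k (delete x c) ≤ χ (x ∈ᵇ c) * A + B
    deleting x with x ∈ᵇ c in x∈c
    ... | false = ≤-trans (≤-reflexive (cong (λ c″ → n ^ ℓ * coverCount k c″) (delete-∉ x c x∈c)))
                          (coverCount-bound k c distinct)
    ... | true  = begin
        n * n ^ l * coverCount k (delete x c)
      ≡⟨ *-assoc n (n ^ l) _ ⟩
        n * (n ^ l * coverCount k (delete x c))
      ≡⟨ cong (λ m → n * (n ^ m * coverCount k (delete x c))) |delete|≡l ⟨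
        n * (n ^ length (delete x c) * coverCount k (delete x c))
      ≤⟨ *-monoʳ-≤ n (coverCount-bound k (delete x c)
                                        (distinct-filterᵇ (λ z → not (z ≟ᵇ x)) c distinct)) ⟩
        n * (k ^ length (delete x c) * n ^ k)
      ≡⟨ cong (λ m → n * (k ^ m * n ^ k)) |delete|≡l ⟩
        A
      ≤⟨ m≤m+n A B ⟩
        A + B
      ≡⟨ cong (_+ B) (+-identityʳ A) ⟨
        1 * A + B ∎
      where
      |delete|≡l : length (delete x c) ≡ l
      |delete|≡l = suc-injective (length-delete x c distinct x∈c)

-- Good sequences

module _ {n : ℕ} (D : Digraph n) where

  goodᵇ : List (Fin n) → Bool
  goodᵇ s = all (λ x → any (adj D x) s) s

  -- nonOut v contains v itself since D has no loops; nonOut′ v leaves it out.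
  nonOut : Fin n → Fin n → Bool
  nonOut v y = not (adj D v y)

  nonOut′ : Fin n → Fin n → Bool
  nonOut′ v y = not (adj D v y) ∧ not (v ≟ᵇ y)

  χ-all-nonOut′≤nonOut : ∀ s v → χ (all (nonOut′ v) s) ≤ χ (all (nonOut v) s)
  χ-all-nonOut′≤nonOut s v = χ-all-mono (nonOut′ v) (nonOut v) s (λ y → ∧-conicalˡ (nonOut v y) _)

  #nonOut′ : Fin n → ℕ
  #nonOut′ v = ∑[ y ∈ allFin n ] χ (nonOut′ v y)

  ∑-nonOut : ∀ v → ∑[ y ∈ allFin n ] χ (nonOut v y) ≡ suc (#nonOut′ v)
  ∑-nonOut v = begin
      ∑[ y ∈ allFin n ] χ (nonOut v y)
    ≡⟨ ∑-cong (allFin n) split ⟩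
      ∑[ y ∈ allFin n ] (χ (nonOut′ v y) + χ (y ≟ᵇ v))
    ≡⟨ ∑-distrib-+ (allFin n) _ _ ⟩
      #nonOut′ v + ∑[ y ∈ allFin n ] χ (y ≟ᵇ v)
    ≡⟨ cong (#nonOut′ v +_) (∑-≟ᵇ v) ⟩
      #nonOut′ v + 1
    ≡⟨ +-comm (#nonOut′ v) 1 ⟩
      suc (#nonOut′ v) ∎
    where
    open ≡-Reasoning
    split : ∀ y → χ (nonOut v y) ≡ χ (nonOut′ v y) + χ (y ≟ᵇ v)
    split y with v ≟ᵇ y in v≟y
    ... | false rewrite ≟ᵇ-sym y v | v≟y | ∧-identityʳ (not (adj D v y)) = sym (+-identityʳ _)
    ... | true  with ≟ᵇ⇒≡ v≟y
    ...   | refl rewrite ≟ᵇ-refl v | loopless D v = refl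

  outdeg+#nonOut′ : ∀ v → outdeg D v + suc (#nonOut′ v) ≡ n
  outdeg+#nonOut′ v = begin
      outdeg D v + suc (#nonOut′ v)
    ≡⟨ cong₂ _+_ (length-filterᵇ (adj D v) (allFin n)) (sym (∑-nonOut v)) ⟩
      ∑[ y ∈ allFin n ] χ (adj D v y) + ∑[ y ∈ allFin n ] χ (nonOut v y)
    ≡⟨ ∑-distrib-+ (allFin n) _ _ ⟨
      ∑[ y ∈ allFin n ] (χ (adj D v y) + χ (nonOut v y))
    ≡⟨ ∑-cong (allFin n) (λ y → χ-+-χ-not (adj D v y)) ⟩
      ∑[ _ ∈ allFin n ] 1
    ≡⟨ trans (∑-allFin-const n 1) (*-identityʳ n) ⟩
      n ∎
    where open ≡-Reasoning

  -- A bad s has a vertex v ∈ s with s ⊆ nonOut v; since v ∈ s, s ⊈ nonOut′ v.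
  not-good+∑-nonOut′≤∑-nonOut : ∀ s →
    χ (not (goodᵇ s)) + ∑[ v ∈ allFin n ] χ (all (nonOut′ v) s)
      ≤ ∑[ v ∈ allFin n ] χ (all (nonOut v) s)
  not-good+∑-nonOut′≤∑-nonOut s with goodᵇ s in good
  ... | true  = ∑-mono-≤ (allFin n) (χ-all-nonOut′≤nonOut s)
  ... | false with all-false⇒∃ (λ x → any (adj D x) s) s good
  ...   | v , v∈s , no-out = ∑-mono-< _ _ (∈-allFin v) (χ-all-nonOut′≤nonOut s) v-bad
    where
    v∉nonOut′ : nonOut′ v v ≡ false
    v∉nonOut′ = trans (cong (λ b → not (adj D v v) ∧ not b) (≟ᵇ-refl v)) (∧-zeroʳ _)
    v-bad : χ (all (nonOut′ v) s) < χ (all (nonOut v) s)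
    v-bad rewrite all-∈-false (nonOut′ v) v∈s v∉nonOut′ | any-false⇒all-not (adj D v) s no-out = ≤-refl

  goodCount : ℕ → ℕ
  goodCount k = ∑[ s ∈ allLists n k ] χ (goodᵇ s)

  badCount : ℕ → ℕ
  badCount k = ∑[ s ∈ allLists n k ] χ (not (goodᵇ s))

  goodCount+badCount : ∀ k → goodCount k + badCount k ≡ n ^ k
  goodCount+badCount k = trans (sym (∑-distrib-+ (allLists n k) _ _))
    (trans (∑-cong (allLists n k) (λ s → χ-+-χ-not (goodᵇ s))) (∑-allLists-1 k))

  badCount-≤ : ∀ r → badCount (suc r) ≤ ∑[ v ∈ allFin n ] (suc r * suc (#nonOut′ v) ^ r)
  badCount-≤ r = +-cancelʳ-≤ (∑[ v ∈ allFin n ] (#nonOut′ v ^ k)) _ _ (begin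
      badCount k + ∑[ v ∈ allFin n ] (#nonOut′ v ^ k)
    ≡⟨ cong (badCount k +_) (∑-cong (allFin n) (λ v → ∑-allLists-all k (nonOut′ v))) ⟨
      badCount k + ∑[ v ∈ allFin n ] ∑[ s ∈ allLists n k ] χ (all (nonOut′ v) s)
    ≡⟨ cong (badCount k +_) (∑-comm (allFin n) (allLists n k) _) ⟩
      badCount k + ∑[ s ∈ allLists n k ] ∑[ v ∈ allFin n ] χ (all (nonOut′ v) s)
    ≡⟨ ∑-distrib-+ (allLists n k) _ _ ⟨
      ∑[ s ∈ allLists n k ] (χ (not (goodᵇ s)) + ∑[ v ∈ allFin n ] χ (all (nonOut′ v) s))
    ≤⟨ ∑-mono-≤ (allLists n k) not-good+∑-nonOut′≤∑-nonOut ⟩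
      ∑[ s ∈ allLists n k ] ∑[ v ∈ allFin n ] χ (all (nonOut v) s)
    ≡⟨ ∑-comm (allLists n k) (allFin n) _ ⟩
      ∑[ v ∈ allFin n ] ∑[ s ∈ allLists n k ] χ (all (nonOut v) s)
    ≡⟨ ∑-cong (allFin n) (λ v → trans (∑-allLists-all k (nonOut v)) (cong (_^ k) (∑-nonOut v))) ⟩
      ∑[ v ∈ allFin n ] (suc (#nonOut′ v) ^ k)
    ≤⟨ ∑-mono-≤ (allFin n) (λ v → suc-mean-value (#nonOut′ v)) ⟩
      ∑[ v ∈ allFin n ] (#nonOut′ v ^ k + k * suc (#nonOut′ v) ^ r)
    ≡⟨ ∑-distrib-+ (allFin n) _ _ ⟩
      ∑[ v ∈ allFin n ] (#nonOut′ v ^ k) + ∑[ v ∈ allFin n ] (k * suc (#nonOut′ v) ^ r)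
    ≡⟨ +-comm (∑[ v ∈ allFin n ] (#nonOut′ v ^ k)) _ ⟩
      ∑[ v ∈ allFin n ] (k * suc (#nonOut′ v) ^ r) + ∑[ v ∈ allFin n ] (#nonOut′ v ^ k) ∎)
    where
    open ≤-Reasoning
    k = suc r
    suc-mean-value : ∀ a → suc a ^ k ≤ a ^ k + k * suc a ^ r
    suc-mean-value a = ≤-trans (pow-mean-value 1 a r)
      (≤-reflexive (cong (λ m → a ^ k + m * suc a ^ r) (*-identityʳ k)))

  minOutDeg⇒2k·#nonOut^r≤n^r : ∀ r → MinOutDegAtLeastLog D (suc r) →
    ∀ v → 2 * suc r * suc (#nonOut′ v) ^ r ≤ n ^ r
  minOutDeg⇒2k·#nonOut^r≤n^r r minOutDeg v =
    subst (λ m → 2 * suc r * suc (#nonOut′ v) ^ r ≤ m ^ r) n≡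
      (ExpAtLeast⇒C·a^r≤n^r (2 * suc r) r (#nonOut′ v) (outdeg D v)
        (subst (λ m → ExpAtLeast (r * outdeg D v) ((2 * suc r) ^ m)) (sym n≡) (minOutDeg v)))
    where
    n≡ : suc (#nonOut′ v) + outdeg D v ≡ n
    n≡ = trans (+-comm (suc (#nonOut′ v)) (outdeg D v)) (outdeg+#nonOut′ v)

  minOutDeg⇒n^k≤2*goodCount : ∀ r → MinOutDegAtLeastLog D (suc r) → n ^ suc r ≤ 2 * goodCount (suc r)
  minOutDeg⇒n^k≤2*goodCount r minOutDeg = +-cancelʳ-≤ (n ^ k) (n ^ k) (2 * goodCount k) (begin
      n ^ k + n ^ k
    ≡⟨ cong (n ^ k +_) (+-identityʳ (n ^ k)) ⟨
      2 * n ^ k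
    ≡⟨ cong (2 *_) (goodCount+badCount k) ⟨
      2 * (goodCount k + badCount k)
    ≡⟨ *-distribˡ-+ 2 (goodCount k) (badCount k) ⟩
      2 * goodCount k + 2 * badCount k
    ≤⟨ +-monoʳ-≤ (2 * goodCount k) 2*badCount≤n^k ⟩
      2 * goodCount k + n ^ k ∎)
    where
    open ≤-Reasoning
    k = suc r
    2*badCount≤n^k : 2 * badCount k ≤ n ^ k
    2*badCount≤n^k = begin
      2 * badCount k                                 ≤⟨ *-monoʳ-≤ 2 (badCount-≤ r) ⟩
      2 * ∑[ v ∈ allFin n ] (k * suc (#nonOut′ v) ^ r) ≡⟨ ∑-*ˡ (allFin n) 2 _ ⟨
      ∑[ v ∈ allFin n ] (2 * (k * suc (#nonOut′ v) ^ r))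
        ≤⟨ ∑-mono-≤ (allFin n) (λ v → ≤-trans (≤-reflexive (sym (*-assoc 2 k _)))
                                               (minOutDeg⇒2k·#nonOut^r≤n^r r minOutDeg v)) ⟩
      ∑[ _ ∈ allFin n ] (n ^ r)                        ≡⟨ ∑-allFin-const n (n ^ r) ⟩
      n ^ k                                          ∎

-- Cycles inside good sequences

module _ {n : ℕ} (D : Digraph n) where

  record CycleWithin (s : List (Fin n)) : Set where
    field
      cycle    : List (Fin n)
      2≤length : 2 ≤ length cycle
      isCycle  : isCycleᵇ D cycle ≡ true
      within   : cycle ⊆ᵇ s ≡ true

  -- The walk x ∷ xs either closes up on a vertex it already visited or grows; it cannot grow
  -- beyond length s, since it stays a list of distinct elements of s.
  extend-walk : ∀ {s} → goodᵇ D s ≡ true → ∀ fuel x xs → length s < fuel + length (x ∷ xs) →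
    distinctᵇ (x ∷ xs) ≡ true → pathᵇ D (x ∷ xs) ≡ true → (x ∷ xs) ⊆ᵇ s ≡ true →
    CycleWithin s
  extend-walk {s} good zero x xs short distinct path within =
    contradiction (distinct-⊆ᵇ⇒length-≤ {xs = x ∷ xs} {ys = s} distinct within) (<⇒≱ short)
  extend-walk {s} good (suc fuel) x xs short distinct path within
    with any-true⇒∃ (adj D (last x xs)) s
                    (all-∈ _ good (⊆ᵇ⇒⊆ {xs = x ∷ xs} {ys = s} within (last∈ x xs)))
  ... | y , y∈s , last→y with y ∈ᵇ (x ∷ xs) in y∈walk
  ...   | false = extend-walk good fuel x (xs ++ [ y ]) short′ distinct′ path′ within′
    where
    short′ : length s < fuel + length (x ∷ xs ++ [ y ])
    short′ = subst (length s <_) (trans (sym (+-suc fuel (length (x ∷ xs))))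
                                        (cong (λ m → fuel + suc m) (sym (length-snoc xs y)))) short
    distinct′ : distinctᵇ (x ∷ xs ++ [ y ]) ≡ true
    distinct′ rewrite distinct-snoc (x ∷ xs) y | y∈walk = distinct
    path′ : pathᵇ D (x ∷ xs ++ [ y ]) ≡ true
    path′ rewrite path-snoc D x xs y | path | last→y = refl
    within′ : (x ∷ xs ++ [ y ]) ⊆ᵇ s ≡ true
    within′ rewrite all-++ (_∈ᵇ s) (x ∷ xs) [ y ] | within | ∈⇒∈ᵇ y∈s = refl
  ...   | true with ∈-∃++ (∈ᵇ⇒∈ (x ∷ xs) y∈walk)
  ...     | pre , post , walk≡ = record
    { cycle    = y ∷ post
    ; 2≤length = 2≤length
    ; isCycle  = isCycle
    ; within   = all-++⁻ʳ (_∈ᵇ s) pre (subst (λ w → w ⊆ᵇ s ≡ true) walk≡ within)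
    }
    where
    last≡ : last x xs ≡ last y post
    last≡ = last-split pre y post walk≡
    2≤length : 2 ≤ length (y ∷ post)
    2≤length = no-loop post last≡
      where
      no-loop : ∀ post → last x xs ≡ last y post → 2 ≤ length (y ∷ post)
      no-loop (_ ∷ _) _     = s≤s (s≤s z≤n)
      no-loop []      x≡y =
        contradiction (trans (sym (loopless D y)) (subst (λ z → adj D z y ≡ true) x≡y last→y)) λ ()
    isCycle : isCycleᵇ D (y ∷ post) ≡ true
    isCycle rewrite distinct-++ʳ pre (subst (λ w → distinctᵇ w ≡ true) walk≡ distinct)
                  | path-snoc D y post y
                  | path-++ʳ D pre (subst (λ w → pathᵇ D w ≡ true) walk≡ path)
                  | sym last≡ | last→y = refl

  good⇒CycleWithin : ∀ x s → goodᵇ D (x ∷ s) ≡ true → CycleWithin (x ∷ s)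
  good⇒CycleWithin x s good =
    extend-walk good (length (x ∷ s)) x [] (m<m+n (length (x ∷ s)) (s≤s z≤n)) refl refl x∈x∷s
    where
    x∈x∷s : [ x ] ⊆ᵇ (x ∷ s) ≡ true
    x∈x∷s rewrite ≟ᵇ-refl x = refl

  good⇒canonical-cycle : ∀ x s → goodᵇ D (x ∷ s) ≡ true →
    ∃[ c ] 2 ≤ length c × length c ≤ length (x ∷ s) ×
           canonicalCycleᵇ D c ≡ true × c ⊆ᵇ (x ∷ s) ≡ true
  good⇒canonical-cycle x s good with good⇒CycleWithin x s good
  ... | record { cycle = y ∷ ys ; 2≤length = 2≤length ; isCycle = isCycle ; within = within }
    with canonical-rotation y ys
  ...   | j , canonical = c , 2≤|c| , |c|≤|s| , isCycle∧canonical , c⊆s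
    where
    c = rotN j (y ∷ ys)
    2≤|c| : 2 ≤ length c
    2≤|c| = ≤-trans 2≤length (≤-reflexive (sym (length-rotN j (y ∷ ys))))
    isCycle∧canonical : (isCycleᵇ D c ∧ canonicalᵇ c) ≡ true
    isCycle∧canonical rewrite isCycle-rotN D j (y ∷ ys) | isCycle | canonical = refl
    c⊆s : c ⊆ᵇ (x ∷ s) ≡ true
    c⊆s = trans (all-rotN (_∈ᵇ (x ∷ s)) j (y ∷ ys)) within
    |c|≤|s| : length c ≤ length (x ∷ s)
    |c|≤|s| = distinct-⊆ᵇ⇒length-≤ {xs = c} {ys = x ∷ s}
      (∧-conicalˡ _ _ (∧-conicalˡ _ _ isCycle∧canonical)) c⊆s

-- Counting good sequences through their cycles

module _ {n : ℕ} (D : Digraph n) where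

  coveredCycleCount : ℕ → ℕ → ℕ
  coveredCycleCount k ℓ = ∑[ c ∈ allLists n ℓ ] (χ (canonicalCycleᵇ D c) * coverCount k c)

  χ-cycleIn : List (Fin n) → List (Fin n) → ℕ
  χ-cycleIn s c = χ (canonicalCycleᵇ D c) * χ (c ⊆ᵇ s)

  χ-good≤∑-cycleIn : ∀ r s → length s ≡ suc r →
    χ (goodᵇ D s) ≤ ∑[ j ∈ upTo r ] ∑[ c ∈ allLists n (2 + j) ] χ-cycleIn s c
  χ-good≤∑-cycleIn .(length s) (x ∷ s) refl with goodᵇ D (x ∷ s) in good
  ... | false = z≤n
  ... | true with good⇒canonical-cycle D x s good
  ...   | _ ∷ [] , s≤s () , _
  ...   | c@(_ ∷ _ ∷ cs) , _ , s≤s |c|≤1+|s| , canonical-cycle , c⊆s = begin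
      1
    ≡⟨ cong₂ (λ a b → χ a * χ b) canonical-cycle c⊆s ⟨
      χ-cycleIn (x ∷ s) c
    ≤⟨ ≤∑-allLists (2 + length cs) (χ-cycleIn (x ∷ s)) c refl ⟩
      ∑[ c′ ∈ allLists n (2 + length cs) ] χ-cycleIn (x ∷ s) c′
    ≤⟨ ∈⇒≤∑ (λ j → ∑[ c′ ∈ allLists n (2 + j) ] χ-cycleIn (x ∷ s) c′)
            (∈-upTo⁺ |c|≤1+|s|) ⟩
      ∑[ j ∈ upTo (length s) ] ∑[ c′ ∈ allLists n (2 + j) ] χ-cycleIn (x ∷ s) c′ ∎
    where open ≤-Reasoning

  goodCount≤∑-coveredCycleCount : ∀ r →
    goodCount D (suc r) ≤ ∑[ j ∈ upTo r ] coveredCycleCount (suc r) (2 + j)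
  goodCount≤∑-coveredCycleCount r = begin
      goodCount D k
    ≤⟨ ∑-allLists-mono-≤ k (χ-good≤∑-cycleIn r) ⟩
      ∑[ s ∈ allLists n k ] ∑[ j ∈ upTo r ] ∑[ c ∈ allLists n (2 + j) ] χ-cycleIn s c
    ≡⟨ ∑-comm (allLists n k) (upTo r) _ ⟩
      ∑[ j ∈ upTo r ] ∑[ s ∈ allLists n k ] ∑[ c ∈ allLists n (2 + j) ] χ-cycleIn s c
    ≡⟨ ∑-cong (upTo r) (λ j → ∑-comm (allLists n k) (allLists n (2 + j)) χ-cycleIn) ⟩
      ∑[ j ∈ upTo r ] ∑[ c ∈ allLists n (2 + j) ] ∑[ s ∈ allLists n k ] χ-cycleIn s c
    ≡⟨ ∑-cong (upTo r) (λ j → ∑-cong (allLists n (2 + j)) (λ c →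
         ∑-*ˡ (allLists n k) (χ (canonicalCycleᵇ D c)) (λ s → χ (c ⊆ᵇ s)))) ⟩
      ∑[ j ∈ upTo r ] coveredCycleCount k (2 + j) ∎
    where
    open ≤-Reasoning
    k = suc r

  n^ℓ*coveredCycleCount≤ : ∀ k ℓ →
    n ^ ℓ * coveredCycleCount k ℓ ≤ canonicalCycleCount D ℓ * (k ^ ℓ * n ^ k)
  n^ℓ*coveredCycleCount≤ k ℓ = begin
      n ^ ℓ * coveredCycleCount k ℓ
    ≡⟨ ∑-*ˡ (allLists n ℓ) (n ^ ℓ) _ ⟨
      ∑[ c ∈ allLists n ℓ ] (n ^ ℓ * (χ (canonicalCycleᵇ D c) * coverCount k c))
    ≤⟨ ∑-allLists-mono-≤ ℓ bound ⟩
      ∑[ c ∈ allLists n ℓ ] (χ (canonicalCycleᵇ D c) * (k ^ ℓ * n ^ k))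
    ≡⟨ ∑-*ʳ (allLists n ℓ) (k ^ ℓ * n ^ k) _ ⟩
      canonicalCycleCount D ℓ * (k ^ ℓ * n ^ k) ∎
    where
    open ≤-Reasoning
    bound : ∀ c → length c ≡ ℓ →
      n ^ ℓ * (χ (canonicalCycleᵇ D c) * coverCount k c) ≤ χ (canonicalCycleᵇ D c) * (k ^ ℓ * n ^ k)
    bound c refl with canonicalCycleᵇ D c in cycle
    ... | true  = subst₂ _≤_ (cong (n ^ length c *_) (sym (+-identityʳ _))) (sym (+-identityʳ _))
                         (coverCount-bound k c (∧-conicalˡ _ _ (∧-conicalˡ _ _ cycle)))
    ... | false = ≤-reflexive (*-zeroʳ (n ^ length c))

  few-cycles⇒2k·coveredCycleCount<n^k : .{{_ : NonZero n}} → ∀ k ℓ →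
    2 * k ^ suc ℓ * numCycles D ℓ < n ^ ℓ → 2 * k * coveredCycleCount k ℓ < n ^ k
  few-cycles⇒2k·coveredCycleCount<n^k k ℓ few = *-cancelˡ-< (n ^ ℓ) _ _ (begin-strict
      n ^ ℓ * (2 * k * coveredCycleCount k ℓ)
    ≡⟨ x∙yz≈y∙xz (n ^ ℓ) (2 * k) _ ⟩
      2 * k * (n ^ ℓ * coveredCycleCount k ℓ)
    ≤⟨ *-monoʳ-≤ (2 * k) (n^ℓ*coveredCycleCount≤ k ℓ) ⟩
      2 * k * (canonicalCycleCount D ℓ * (k ^ ℓ * n ^ k))
    ≡⟨ lemma k (canonicalCycleCount D ℓ) (k ^ ℓ) (n ^ k) ⟩
      2 * k ^ suc ℓ * canonicalCycleCount D ℓ * n ^ k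
    ≤⟨ *-monoˡ-≤ (n ^ k) (*-monoʳ-≤ (2 * k ^ suc ℓ) (canonicalCycleCount≤numCycles D ℓ)) ⟩
      2 * k ^ suc ℓ * numCycles D ℓ * n ^ k
    <⟨ *-monoˡ-< (n ^ k) {{m^n≢0 n k}} few ⟩
      n ^ ℓ * n ^ k ∎)
    where
    open ≤-Reasoning
    lemma : ∀ k K P N → 2 * k * (K * (P * N)) ≡ 2 * (k * P) * K * N
    lemma = solve-∀

  minOutDeg⇒¬few-cycles : .{{_ : NonZero n}} → ∀ r → 1 ≤ r → MinOutDegAtLeastLog D (suc r) →
    ¬ (∀ {j} → j < r → 2 * suc r ^ (3 + j) * numCycles D (2 + j) < n ^ (2 + j))
  minOutDeg⇒¬few-cycles r 1≤r minOutDeg few = contradiction r≤0 (<⇒≱ 1≤r)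
    where
    open ≤-Reasoning
    k = suc r
    good = goodCount D k
    2k·good+r≤r·n^k : 2 * k * good + r ≤ r * n ^ k
    2k·good+r≤r·n^k = begin
        2 * k * good + r
      ≤⟨ +-monoˡ-≤ r (*-monoʳ-≤ (2 * k) (goodCount≤∑-coveredCycleCount r)) ⟩
        2 * k * ∑[ j ∈ upTo r ] coveredCycleCount k (2 + j) + r
      ≡⟨ cong₂ _+_ (∑-*ˡ (upTo r) (2 * k) _)
                   (trans (∑-const (upTo r) 1) (trans (cong (_* 1) (length-upTo r)) (*-identityʳ r))) ⟨
        ∑[ j ∈ upTo r ] (2 * k * coveredCycleCount k (2 + j)) + ∑[ _ ∈ upTo r ] 1
      ≡⟨ ∑-distrib-+ (upTo r) _ _ ⟨
        ∑[ j ∈ upTo r ] (2 * k * coveredCycleCount k (2 + j) + 1)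
      ≤⟨ ∑-mono-≤-on (upTo r) (λ {j} j∈ → ≤-trans (≤-reflexive (+-comm _ 1))
           (few-cycles⇒2k·coveredCycleCount<n^k k (2 + j) (few (∈-upTo⁻ j∈)))) ⟩
        ∑[ _ ∈ upTo r ] (n ^ k)
      ≡⟨ trans (∑-const (upTo r) (n ^ k)) (cong (_* n ^ k) (length-upTo r)) ⟩
        r * n ^ k ∎
    r≤0 : r ≤ 0
    r≤0 = +-cancelˡ-≤ (2 * k * good) r 0 (begin
      2 * k * good + r ≤⟨ 2k·good+r≤r·n^k ⟩
      r * n ^ k        ≤⟨ *-monoʳ-≤ r (minOutDeg⇒n^k≤2*goodCount D r minOutDeg) ⟩
      r * (2 * good)   ≤⟨ *-monoˡ-≤ (2 * good) (n≤1+n r) ⟩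
      k * (2 * good)   ≡⟨ lemma k good ⟩
      2 * k * good + 0 ∎)
      where
      lemma : ∀ k g → k * (2 * g) ≡ 2 * k * g + 0
      lemma = solve-∀

lemma2p1 : (k : ℕ) → 2 ≤ k → (n : ℕ) → (D : Digraph n) →
    MinOutDegAtLeastLog D k →
    Σ ℕ (λ ℓ → 2 ≤ ℓ × ℓ ≤ k × n ^ ℓ ≤ 2 * k ^ suc ℓ * numCycles D ℓ)
lemma2p1 k       2≤k         zero       D _ = 2 , ≤-refl , 2≤k , z≤n
lemma2p1 (suc r) (s≤s 1≤r) n@(suc _) D minOutDeg
  with anyUpTo? (λ j → n ^ (2 + j) ≤? 2 * suc r ^ (3 + j) * numCycles D (2 + j)) r
... | yes (j , j<r , many) = 2 + j , s≤s (s≤s z≤n) , s≤s j<r , many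
... | no  ¬many = contradiction (λ {j} j<r → ≰⇒> (λ many → ¬many (j , j<r , many)))
                                (minOutDeg⇒¬few-cycles D r 1≤r minOutDeg)
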